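{- Let $V$ be a finite set of $n\ge1$ vertices with a metric $d$, let $k\ge1$ and $0\le q<n$ be integers, and let $l\ge0$ be an integer. Then the output $(S,O,\sigma)$ of Algorithm 3 (described below) on input $(V,d,k,q)$ and $l$ is a feasible solution of the IF$k$CO instance $(V,d,k,q)$, i.e. $|S|\le k$ and $|O|\le q$.
   Context: A metric $d$ on $V$ satisfies $d_{ij}\ge0$, $d_{ii}=0$, $d_{ij}=d_{ji}$ and $d_{hi}+d_{ij}\ge d_{hj}$. For $i\in V$, $NR_q(i)$ is the distance from $i$ to its $\lceil (n-q)/k\rceil$-th nearest neighbour in $V$ ($i$ counts as its own first nearest neighbour). A solution of the IF$k$CO instance $(V,d,k,q)$ is a triple $(S,O,\sigma)$ with $S\subseteq V$, $O\subseteq V$, $\sigma:V\setminus O\to S$; it is feasible if $|S|\le k$ and $|O|\le q$. For a real $\beta>0$, the procedure $G(\beta)$ is: start with $P:=V$, $S:=\emptyset$; while $P\neq\emptyset$ and $|S|<k$, choose $s\in P$ with $s\in\arg\min_{i\in P} NR_q(i)$ (ties arbitrary), set $S:=S\cup\{s\}$ and $P:=\{i\in P: d_{is}>\beta\,NR_q(i)\}$; finally output $(S,O,\sigma)$ with $O:=P$ and $\sigma(i)\in\arg\min_{h\in S}d_{ih}$ for $i\in V\setminus O$. Algorithm 2 is $G(2)$. Algorithm 3 (input $(V,d,k,q)$ and $l$): let the current solution be the output of Algorithm 2; set $t:=0$, $\beta_1:=1$, $\beta_2:=2$, $\beta:=1$. While $t<l$: compute $(S_\beta,O_\beta,\sigma_\beta):=G(\beta)$;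 if $|O_\beta|>q$, set $\beta_1:=\beta$; otherwise replace the current solution by $(S_\beta,O_\beta,\sigma_\beta)$ and set $\beta_2:=\beta$; in either case then set $\beta:=(\beta_1+\beta_2)/2$ and $t:=t+1$. Output the current solution.
   Formalization: The distances $d_{ij}$ of the metric on V take rational values. -}

module Defs where

open import Data.Nat using (ℕ; zero; suc; _∸_) renaming (_+_ to _+ℕ_; _≤_ to _≤ℕ_; _<_ to _<ℕ_)
open import Data.Nat.DivMod using (_/_)
open import Data.Bool using (Bool; _∧_)
open import Data.Fin using (Fin)
open import Data.Fin.Subset using (Subset; _∈_; _∉_; ⁅_⁆; _∪_; ∣_∣; Empty; ⊤; ⊥)
open import Data.List using (List; map; allFin; []; _∷_)
open import Data.Vec using (tabulate; lookup)
open import Data.Rational using (ℚ; 0ℚ; 1ℚ; ½; _+_; _*_; _≤_; _<_)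
open import Data.Rational.Properties using (≤-decTotalOrder; _<?_)
open import Data.List.Sort ≤-decTotalOrder using (sort)
open import Data.Product using (Σ; _×_; _,_)
open import Data.Sum using (_⊎_)
open import Relation.Binary.PropositionalEquality using (_≡_)
open import Relation.Nullary.Decidable using (⌊_⌋)

record IsMetric {n : ℕ} (d : Fin n → Fin n → ℚ) : Set where
  field
    nonneg : ∀ i j → 0ℚ ≤ d i j
    zero-diag : ∀ i → d i i ≡ 0ℚ
    symmetric : ∀ i j → d i j ≡ d j i
    triangle : ∀ h i j → d h j ≤ d h i + d i j

-- ⌈ a / k ⌉ (for k ≥ 1; arbitrary value 0 when k = 0)
ceilDiv : ℕ → ℕ → ℕ
ceilDiv a zero = 0
ceilDiv a (suc k) = (a +ℕ k) / suc k

nth : List ℚ → ℕ → ℚ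
nth [] _ = 0ℚ
nth (x ∷ xs) zero = x
nth (x ∷ xs) (suc m) = nth xs m

-- NR_q(i): distance from i to its ⌈(n-q)/k⌉-th nearest neighbour (i is its own 1st)
NR : {n : ℕ} → (Fin n → Fin n → ℚ) → (k q : ℕ) → Fin n → ℚ
NR {n} d k q i = nth (sort (map (d i) (allFin n))) (ceilDiv (n ∸ q) k ∸ 1)

shrink : {n : ℕ} → (Fin n → Fin n → ℚ) → (k q : ℕ) → ℚ → Subset n → Fin n → Subset n
shrink d k q β P s = tabulate (λ i → lookup P i ∧ ⌊ (β * NR d k q i) <? d i s ⌋)

-- While loop of G(β): GLoop P S P' S' means that starting from (P, S) the loop may
-- terminate with (P', S') (for some admissible tie-breaking).
data GLoop {n : ℕ} (d : Fin n → Fin n → ℚ) (k q : ℕ) (β : ℚ) :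
       Subset n → Subset n → Subset n → Subset n → Set where
  stop : ∀ {P S} → (Empty P ⊎ k ≤ℕ ∣ S ∣) → GLoop d k q β P S P S
  step : ∀ {P S P' S'} (s : Fin n) → s ∈ P → ∣ S ∣ <ℕ k →
         (∀ i → i ∈ P → NR d k q s ≤ NR d k q i) →
         GLoop d k q β (shrink d k q β P s) (S ∪ ⁅ s ⁆) P' S' →
         GLoop d k q β P S P' S'

record Solution (n : ℕ) : Set where
  constructor sol
  field
    S : Subset n
    O : Subset n
    σ : (i : Fin n) → i ∉ O → Fin n
open Solution public

G : {n : ℕ} → (Fin n → Fin n → ℚ) → (k q : ℕ) → ℚ → Solution n → Set
G d k q β x =
  GLoop d k q β ⊤ ⊥ (O x) (S x) ×
  (∀ i (i∉O : i ∉ O x) → σ x i i∉O ∈ S x × (∀ h → h ∈ S x → d i (σ x i i∉O) ≤ d i h))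

two : ℚ
two = 1ℚ + 1ℚ

-- Loop of Algorithm 3; the ℕ index is the number l - t of remaining iterations.
-- A3Loop r β₁ β₂ β cur out : from state (t = l - r, β₁, β₂, β, current solution cur)
-- the algorithm may output out.
data A3Loop {n : ℕ} (d : Fin n → Fin n → ℚ) (k q : ℕ) :
       ℕ → ℚ → ℚ → ℚ → Solution n → Solution n → Set where
  done : ∀ {β₁ β₂ β cur} → A3Loop d k q zero β₁ β₂ β cur cur
  reject : ∀ {r β₁ β₂ β cur out} (x : Solution n) → G d k q β x → q <ℕ ∣ O x ∣ →
           A3Loop d k q r β β₂ ((β + β₂) * ½) cur out →
           A3Loop d k q (suc r) β₁ β₂ β cur out
  accept : ∀ {r β₁ β₂ β cur out} (x : Solution n) → G d k q β x → ∣ O x ∣ ≤ℕ q →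
           A3Loop d k q r β₁ β ((β₁ + β) * ½) x out →
           A3Loop d k q (suc r) β₁ β₂ β cur out

Algorithm3 : {n : ℕ} → (Fin n → Fin n → ℚ) → (k q l : ℕ) → Solution n → Set
Algorithm3 d k q l out =
  Σ (Solution _) (λ init → G d k q two init × A3Loop d k q l 1ℚ two 1ℚ init out)

{-# OPTIONS --safe #-}
module Submission where

-- Let m = ⌈(n - q)/k⌉. The ball {j : d s j ≤ NR_q(s)} around any point s has at least m
-- points. G(β) picks centres in order of increasing NR_q, and a point i stays a candidate
-- after s is picked only if d i s > β NR_q(i) ≥ NR_q(i) + NR_q(s) when β ≥ 2; by the
-- triangle inequality the ball around s then misses the balls of all later centres and all
-- remaining candidates (each candidate lies in its own ball). So when G stops with k
-- centres, its outliers avoid at least k m ≥ n - q points. G never opens more than k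
-- centres, and Algorithm 3 only ever keeps an output of G with at most q outliers.

open import Defs
open import Data.Nat using (ℕ; _≤_; _<_)
open import Data.Fin using (Fin)
open import Data.Fin.Subset using (∣_∣)
open import Data.Rational using (ℚ)
open import Data.Product using (_×_)

open import Level using (Level)
open import Data.Nat using (zero; suc; _+_; _*_; _∸_; z≤n; s≤s; s≤s⁻¹; NonZero)
open import Data.Nat.Properties
  using (≤-trans; +-comm; +-suc; +-identityʳ; m≤m+n; +-mono-≤; +-monoˡ-≤; +-monoʳ-≤; +-cancelˡ-≤;
         *-comm; *-monoˡ-≤; m≤m*n; m≤n+m∸n; m∸n≤m; ∸-monoˡ-≤; module ≤-Reasoning)
open import Data.Nat.DivMod using (_%_; m≡m%n+[m/n]*n; m%n<n; m<n*o⇒m/o<n)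
open import Data.Bool using (Bool; T)
import Data.Fin as Fin
open import Data.Bool.Properties using (T-≡; T-∧)
open import Data.Empty using (⊥-elim) renaming (⊥ to False)
open import Data.Fin.Subset using (Subset; _∈_; _∪_; _∩_; ⁅_⁆; Empty; ⊥; inside; outside)
open import Data.Fin.Subset.Properties using (∣p∣≤n; ∣⊥∣≡0; ∣⁅x⁆∣≡1; ∉⊥; Empty-unique; x∈p∩q⁻; x∈p∪q⁻)
open import Data.List using (_∷_; length; map; filter; allFin)
import Data.List as List
open import Data.List.Properties using (filter-accept; map-tabulate; length-tabulate)
open import Data.List.Relation.Unary.All using (All; _∷_)
open import Data.List.Relation.Unary.All.Properties using (tabulate⁺)
open import Data.List.Relation.Unary.AllPairs using (AllPairs; _∷_)
open import Data.List.Relation.Unary.Linked.Properties using (Linked⇒AllPairs)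
open import Data.List.Relation.Binary.Permutation.Propositional using (_↭_; ↭-sym)
open import Data.List.Relation.Binary.Permutation.Propositional.Properties using (All-resp-↭; ↭-length; filter-↭)
import Data.Rational as ℚ
open import Data.Rational.Properties using (≤-decTotalOrder; _≤?_)
import Data.Rational.Properties as ℚ
open import Data.List.Sort ≤-decTotalOrder using (sort; sort-↭; sort-↗)
open import Data.Product using (∃-syntax; _,_; proj₁; proj₂)
open import Data.Sum using (inj₁; inj₂)
import Data.Vec as Vec
open import Data.Vec.Properties using (lookup∘tabulate; []=⇒lookup; lookup⇒[]=)
open import Function.Base using (_∘_)
open import Function.Bundles using (Equivalence)
open import Relation.Binary.PropositionalEquality using (_≡_; refl; sym; trans; cong; cong₂; subst; module ≡-Reasoning)
open import Relation.Nullary.Decidable using (⌊_⌋; yes; no; toWitness; fromWitness)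
open import Relation.Unary using (Pred; Decidable)

private
  variable
    a ℓ : Level
    A : Set a
    n : ℕ

⌈m/n⌉≤m : ∀ m k → ceilDiv m k ≤ m
⌈m/n⌉≤m m zero = z≤n
⌈m/n⌉≤m m (suc k) = s≤s⁻¹ (m<n*o⇒m/o<n (begin-strict
  m + k            ≡⟨ +-comm m k ⟩
  k + m            <⟨ s≤s (+-monoʳ-≤ k (m≤m*n m (suc k))) ⟩
  suc m * suc k    ∎))
  where open ≤-Reasoning

m≤⌈m/n⌉*n : ∀ m k .{{_ : NonZero k}} → m ≤ ceilDiv m k * k
m≤⌈m/n⌉*n m (suc k) = +-cancelˡ-≤ k m _ (begin
  k + m                                    ≡⟨ +-comm k m ⟩
  m + k                                    ≡⟨ m≡m%n+[m/n]*n (m + k) (suc k) ⟩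
  (m + k) % suc k + ceilDiv m (suc k) * suc k ≤⟨ +-monoˡ-≤ _ (s≤s⁻¹ (m%n<n (m + k) (suc k))) ⟩
  k + ceilDiv m (suc k) * suc k            ∎)
  where open ≤-Reasoning

∣p∪q∣+∣p∩q∣≡∣p∣+∣q∣ : ∀ (p q : Subset n) → ∣ p ∪ q ∣ + ∣ p ∩ q ∣ ≡ ∣ p ∣ + ∣ q ∣
∣p∪q∣+∣p∩q∣≡∣p∣+∣q∣ Vec.[] Vec.[] = refl
∣p∪q∣+∣p∩q∣≡∣p∣+∣q∣ (inside Vec.∷ p) (inside Vec.∷ q) = begin
  suc (∣ p ∪ q ∣ + suc ∣ p ∩ q ∣) ≡⟨ cong suc (+-suc ∣ p ∪ q ∣ ∣ p ∩ q ∣) ⟩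
  suc (suc (∣ p ∪ q ∣ + ∣ p ∩ q ∣)) ≡⟨ cong (λ x → suc (suc x)) (∣p∪q∣+∣p∩q∣≡∣p∣+∣q∣ p q) ⟩
  suc (suc (∣ p ∣ + ∣ q ∣))        ≡⟨ cong suc (sym (+-suc ∣ p ∣ ∣ q ∣)) ⟩
  suc (∣ p ∣ + suc ∣ q ∣)          ∎
  where open ≡-Reasoning
∣p∪q∣+∣p∩q∣≡∣p∣+∣q∣ (inside Vec.∷ p) (outside Vec.∷ q) = cong suc (∣p∪q∣+∣p∩q∣≡∣p∣+∣q∣ p q)
∣p∪q∣+∣p∩q∣≡∣p∣+∣q∣ (outside Vec.∷ p) (inside Vec.∷ q) =
  trans (cong suc (∣p∪q∣+∣p∩q∣≡∣p∣+∣q∣ p q)) (sym (+-suc ∣ p ∣ ∣ q ∣))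
∣p∪q∣+∣p∩q∣≡∣p∣+∣q∣ (outside Vec.∷ p) (outside Vec.∷ q) = ∣p∪q∣+∣p∩q∣≡∣p∣+∣q∣ p q

∣p∪q∣≤∣p∣+∣q∣ : ∀ (p q : Subset n) → ∣ p ∪ q ∣ ≤ ∣ p ∣ + ∣ q ∣
∣p∪q∣≤∣p∣+∣q∣ p q = subst (∣ p ∪ q ∣ ≤_) (∣p∪q∣+∣p∩q∣≡∣p∣+∣q∣ p q) (m≤m+n ∣ p ∪ q ∣ ∣ p ∩ q ∣)

∣p∪⁅x⁆∣≤1+∣p∣ : ∀ (p : Subset n) x → ∣ p ∪ ⁅ x ⁆ ∣ ≤ suc ∣ p ∣
∣p∪⁅x⁆∣≤1+∣p∣ p x = begin
  ∣ p ∪ ⁅ x ⁆ ∣    ≤⟨ ∣p∪q∣≤∣p∣+∣q∣ p ⁅ x ⁆ ⟩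
  ∣ p ∣ + ∣ ⁅ x ⁆ ∣ ≡⟨ cong (∣ p ∣ +_) (∣⁅x⁆∣≡1 x) ⟩
  ∣ p ∣ + 1        ≡⟨ +-comm ∣ p ∣ 1 ⟩
  suc ∣ p ∣        ∎
  where open ≤-Reasoning

Empty[p∩q]⇒∣p∪q∣≡∣p∣+∣q∣ : ∀ (p q : Subset n) → Empty (p ∩ q) → ∣ p ∪ q ∣ ≡ ∣ p ∣ + ∣ q ∣
Empty[p∩q]⇒∣p∪q∣≡∣p∣+∣q∣ {n} p q empty = begin
  ∣ p ∪ q ∣             ≡⟨ sym (+-identityʳ ∣ p ∪ q ∣) ⟩
  ∣ p ∪ q ∣ + 0         ≡⟨ cong (∣ p ∪ q ∣ +_) (sym (∣⊥∣≡0 n)) ⟩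
  ∣ p ∪ q ∣ + ∣ ⊥ {n} ∣ ≡⟨ cong (λ r → ∣ p ∪ q ∣ + ∣ r ∣) (sym (Empty-unique empty)) ⟩
  ∣ p ∪ q ∣ + ∣ p ∩ q ∣ ≡⟨ ∣p∪q∣+∣p∩q∣≡∣p∣+∣q∣ p q ⟩
  ∣ p ∣ + ∣ q ∣         ∎
  where open ≡-Reasoning

∈⇒T-lookup : ∀ {p : Subset n} {x} → x ∈ p → T (Vec.lookup p x)
∈⇒T-lookup x∈p = Equivalence.from T-≡ ([]=⇒lookup x∈p)

T-lookup⇒∈ : ∀ {p : Subset n} {x} → T (Vec.lookup p x) → x ∈ p
T-lookup⇒∈ {p = p} {x} t = lookup⇒[]= x p (Equivalence.to T-≡ t)

∈-tabulate⁻ : ∀ {f : Fin n → Bool} {x} → x ∈ Vec.tabulate f → T (f x)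
∈-tabulate⁻ {f = f} {x} x∈ = subst T (lookup∘tabulate f x) (∈⇒T-lookup x∈)

∈-tabulate⁺ : ∀ {f : Fin n → Bool} {x} → T (f x) → x ∈ Vec.tabulate f
∈-tabulate⁺ {f = f} {x} t = T-lookup⇒∈ (subst T (sym (lookup∘tabulate f x)) t)

∣tabulate∣≡length-filter : ∀ {P : Pred A ℓ} (P? : Decidable P) (f : Fin n → A) →
                            ∣ Vec.tabulate (λ j → ⌊ P? (f j) ⌋) ∣ ≡ length (filter P? (List.tabulate f))
∣tabulate∣≡length-filter {n = zero} P? f = refl
∣tabulate∣≡length-filter {n = suc n} P? f with P? (f Fin.zero)
... | yes _ = cong suc (∣tabulate∣≡length-filter P? (f ∘ Fin.suc))
... | no _  = ∣tabulate∣≡length-filter P? (f ∘ Fin.suc)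

All-nth : ∀ {P : ℚ → Set ℓ} {xs} → All P xs → ∀ {i} → i < length xs → P (nth xs i)
All-nth (px ∷ _)  {zero}  _        = px
All-nth (_ ∷ pxs) {suc i} (s≤s i<) = All-nth pxs i<

AllPairs≤⇒i<∣filter≤nth∣ : ∀ {xs} → AllPairs ℚ._≤_ xs → ∀ {i} → i < length xs →
                           i < length (filter (_≤? nth xs i) xs)
AllPairs≤⇒i<∣filter≤nth∣ {x ∷ xs} (_ ∷ _) {zero} _
  rewrite filter-accept (_≤? x) {xs = xs} (ℚ.≤-refl {x}) = s≤s z≤n
AllPairs≤⇒i<∣filter≤nth∣ {x ∷ xs} (x≤xs ∷ sorted) {suc i} (s≤s i<)
  rewrite filter-accept (_≤? nth xs i) {xs = xs} (All-nth x≤xs i<) =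
  s≤s (AllPairs≤⇒i<∣filter≤nth∣ sorted i<)

-- Indexed from 0, so nthSmallest f 0 is the minimum of f.
nthSmallest : (Fin n → ℚ) → ℕ → ℚ
nthSmallest {n} f i = nth (sort (map f (allFin n))) i

atMost : (Fin n → ℚ) → ℚ → Subset n
atMost f v = Vec.tabulate (λ j → ⌊ f j ≤? v ⌋)

sort-map-allFin↭tabulate : ∀ (f : Fin n → ℚ) → sort (map f (allFin n)) ↭ List.tabulate f
sort-map-allFin↭tabulate {n} f = subst (sort (map f (allFin n)) ↭_) (map-tabulate (λ j → j) f) (sort-↭ (map f (allFin n)))

length-sort-map-allFin : ∀ (f : Fin n → ℚ) → length (sort (map f (allFin n))) ≡ n
length-sort-map-allFin f = trans (↭-length (sort-map-allFin↭tabulate f)) (length-tabulate f)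

nthSmallest-All : ∀ {P : ℚ → Set ℓ} {f : Fin n → ℚ} → (∀ j → P (f j)) → ∀ {i} → i < n → P (nthSmallest f i)
nthSmallest-All {P = P} {f = f} Pf {i} i<n =
  All-nth {P = P} (All-resp-↭ (↭-sym (sort-map-allFin↭tabulate f)) (tabulate⁺ Pf)) (subst (i <_) (sym (length-sort-map-allFin f)) i<n)

i<∣atMost-nthSmallest∣ : ∀ (f : Fin n → ℚ) {i} → i < n → i < ∣ atMost f (nthSmallest f i) ∣
i<∣atMost-nthSmallest∣ {n} f {i} i<n = begin-strict
  i                                               <⟨ AllPairs≤⇒i<∣filter≤nth∣ sorted i<length ⟩
  length (filter (_≤? v) (sort (map f (allFin n)))) ≡⟨ ↭-length (filter-↭ (_≤? v) (sort-map-allFin↭tabulate f)) ⟩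
  length (filter (_≤? v) (List.tabulate f))       ≡⟨ sym (∣tabulate∣≡length-filter (_≤? v) f) ⟩
  ∣ atMost f v ∣                                  ∎
  where
  open ≤-Reasoning
  v = nthSmallest f i
  sorted = Linked⇒AllPairs ℚ.≤-trans (sort-↗ (map f (allFin n)))
  i<length = subst (i <_) (sym (length-sort-map-allFin f)) i<n

m≤n⇒m∸1<n : ∀ {m n} → m ≤ n → 0 < n → m ∸ 1 < n
m≤n⇒m∸1<n m≤n (s≤s _) = s≤s (∸-monoˡ-≤ 1 m≤n)

two*p≡p+p : ∀ p → two ℚ.* p ≡ p ℚ.+ p
two*p≡p+p p = begin
  (ℚ.1ℚ ℚ.+ ℚ.1ℚ) ℚ.* p     ≡⟨ ℚ.*-distribʳ-+ p ℚ.1ℚ ℚ.1ℚ ⟩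
  ℚ.1ℚ ℚ.* p ℚ.+ ℚ.1ℚ ℚ.* p ≡⟨ cong₂ ℚ._+_ (ℚ.*-identityˡ p) (ℚ.*-identityˡ p) ⟩
  p ℚ.+ p                   ∎
  where open ≡-Reasoning

module _ {d : Fin n → Fin n → ℚ} (metric : IsMetric d) (k q : ℕ) (q<n : q < n) where
  open IsMetric metric

  private
    variable
      β : ℚ
      P C U P′ C′ : Subset n
      s i u : Fin n

    nr : Fin n → ℚ
    nr = NR d k q

    m : ℕ
    m = ceilDiv (n ∸ q) k

    m∸1<n : m ∸ 1 < n
    m∸1<n = m≤n⇒m∸1<n (≤-trans (⌈m/n⌉≤m (n ∸ q) k) (m∸n≤m n q)) (≤-trans (s≤s z≤n) q<n)

  Ball : Fin n → Subset n
  Ball s = atMost (d s) (nr s)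

  nr-nonNeg : ∀ i → ℚ.0ℚ ℚ.≤ nr i
  nr-nonNeg i = nthSmallest-All {P = ℚ.0ℚ ℚ.≤_} (nonneg i) m∸1<n

  m≤∣Ball∣ : ∀ s → m ≤ ∣ Ball s ∣
  m≤∣Ball∣ s = ≤-trans (m≤n+m∸n m 1) (i<∣atMost-nthSmallest∣ (d s) m∸1<n)

  ∈Ball⁻ : u ∈ Ball s → d s u ℚ.≤ nr s
  ∈Ball⁻ u∈ = toWitness (∈-tabulate⁻ u∈)

  centre∈Ball : ∀ s → s ∈ Ball s
  centre∈Ball s = ∈-tabulate⁺ (fromWitness (subst (ℚ._≤ nr s) (sym (zero-diag s)) (nr-nonNeg s)))

  meeting-Balls⇒d≤nr+nr : u ∈ Ball s → u ∈ Ball i → d i s ℚ.≤ nr i ℚ.+ nr s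
  meeting-Balls⇒d≤nr+nr {u} {s} {i} u∈s u∈i = begin
    d i s           ≤⟨ triangle i u s ⟩
    d i u ℚ.+ d u s ≤⟨ ℚ.+-mono-≤ (∈Ball⁻ u∈i) (subst (ℚ._≤ nr s) (symmetric s u) (∈Ball⁻ u∈s)) ⟩
    nr i ℚ.+ nr s   ∎
    where open ℚ.≤-Reasoning

  Separated : ℚ → Subset n → Fin n → Set
  Separated β P s = ∀ {i} → i ∈ P → nr s ℚ.≤ nr i × β ℚ.* nr i ℚ.< d i s

  separated⇒disjoint : two ℚ.≤ β → Separated β P s → i ∈ P → u ∈ Ball s → u ∈ Ball i → False
  separated⇒disjoint {β} {s = s} {i} β≥2 sep i∈P u∈s u∈i = ℚ.<-irrefl refl (ℚ.≤-<-trans close far)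
    where
    open ℚ.≤-Reasoning
    nr-s≤nr-i = proj₁ (sep i∈P)
    far = proj₂ (sep i∈P)
    close : d i s ℚ.≤ β ℚ.* nr i
    close = begin
      d i s          ≤⟨ meeting-Balls⇒d≤nr+nr u∈s u∈i ⟩
      nr i ℚ.+ nr s  ≤⟨ ℚ.+-monoʳ-≤ (nr i) nr-s≤nr-i ⟩
      nr i ℚ.+ nr i  ≡⟨ two*p≡p+p (nr i) ⟨
      two ℚ.* nr i   ≤⟨ ℚ.*-monoʳ-≤-nonNeg (nr i) {{ℚ.nonNegative (nr-nonNeg i)}} β≥2 ⟩
      β ℚ.* nr i     ∎

  -- The ghost set U is the union of the balls around the centres chosen so far.
  Covered : ℚ → Subset n → Subset n → Set
  Covered β P U = ∀ {u} → u ∈ U → ∃[ s ] u ∈ Ball s × Separated β P s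

  Covered⇒Empty[U∩P] : two ℚ.≤ β → Covered β P U → Empty (U ∩ P)
  Covered⇒Empty[U∩P] {P = P} {U} β≥2 cov (u , u∈U∩P) with x∈p∩q⁻ U P u∈U∩P
  ... | u∈U , u∈P with cov u∈U
  ... | s , u∈s , sep = separated⇒disjoint β≥2 sep u∈P u∈s (centre∈Ball u)

  Covered⇒Empty[Ball∩U] : two ℚ.≤ β → Covered β P U → s ∈ P → Empty (Ball s ∩ U)
  Covered⇒Empty[Ball∩U] {U = U} {s} β≥2 cov s∈P (u , u∈Bs∩U) with x∈p∩q⁻ (Ball s) U u∈Bs∩U
  ... | u∈s , u∈U with cov u∈U
  ... | s₀ , u∈s₀ , sep = separated⇒disjoint β≥2 sep s∈P u∈s₀ u∈s

  ∈shrink⁻ : i ∈ shrink d k q β P s → i ∈ P × β ℚ.* nr i ℚ.< d i s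
  ∈shrink⁻ i∈ with Equivalence.to T-∧ (∈-tabulate⁻ i∈)
  ... | i∈P , far = T-lookup⇒∈ i∈P , toWitness far

  Covered-shrink : (∀ i → i ∈ P → nr s ℚ.≤ nr i) → Covered β P U →
                   Covered β (shrink d k q β P s) (Ball s ∪ U)
  Covered-shrink {P = P} {s = s} {β = β} {U = U} s-min cov u∈ with x∈p∪q⁻ (Ball s) U u∈
  ... | inj₁ u∈s = s , u∈s , λ i∈ → let i∈P , far = ∈shrink⁻ {β = β} {P = P} i∈ in s-min _ i∈P , far
  ... | inj₂ u∈U with cov u∈U
  ... | s₀ , u∈s₀ , sep = s₀ , u∈s₀ , λ i∈ → sep (proj₁ (∈shrink⁻ {β = β} {P = P} i∈))

  ∣C∪⁅s⁆∣*m≤∣Ball∪U∣ : two ℚ.≤ β → Covered β P U → s ∈ P → ∣ C ∣ * m ≤ ∣ U ∣ →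
                       ∣ C ∪ ⁅ s ⁆ ∣ * m ≤ ∣ Ball s ∪ U ∣
  ∣C∪⁅s⁆∣*m≤∣Ball∪U∣ {U = U} {s} {C} β≥2 cov s∈P size = begin
    ∣ C ∪ ⁅ s ⁆ ∣ * m      ≤⟨ *-monoˡ-≤ m (∣p∪⁅x⁆∣≤1+∣p∣ C s) ⟩
    m + ∣ C ∣ * m          ≤⟨ +-mono-≤ (m≤∣Ball∣ s) size ⟩
    ∣ Ball s ∣ + ∣ U ∣     ≡⟨ Empty[p∩q]⇒∣p∪q∣≡∣p∣+∣q∣ (Ball s) U (Covered⇒Empty[Ball∩U] β≥2 cov s∈P) ⟨
    ∣ Ball s ∪ U ∣         ∎
    where open ≤-Reasoning

  ∣P∣≤q-at-stop : .{{_ : NonZero k}} → two ℚ.≤ β → Covered β P U → ∣ C ∣ * m ≤ ∣ U ∣ → k ≤ ∣ C ∣ → ∣ P ∣ ≤ q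
  ∣P∣≤q-at-stop {P = P} {U} {C} β≥2 cov size k≤∣C∣ = +-cancelˡ-≤ ∣ U ∣ ∣ P ∣ q (begin
    ∣ U ∣ + ∣ P ∣  ≡⟨ Empty[p∩q]⇒∣p∪q∣≡∣p∣+∣q∣ U P (Covered⇒Empty[U∩P] β≥2 cov) ⟨
    ∣ U ∪ P ∣      ≤⟨ ∣p∣≤n (U ∪ P) ⟩
    n              ≤⟨ m≤n+m∸n n q ⟩
    q + (n ∸ q)    ≤⟨ +-monoʳ-≤ q n∸q≤∣U∣ ⟩
    q + ∣ U ∣      ≡⟨ +-comm q ∣ U ∣ ⟩
    ∣ U ∣ + q      ∎)
    where
    open ≤-Reasoning
    n∸q≤∣U∣ : n ∸ q ≤ ∣ U ∣
    n∸q≤∣U∣ = begin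
      n ∸ q      ≤⟨ m≤⌈m/n⌉*n (n ∸ q) k ⟩
      m * k      ≡⟨ *-comm m k ⟩
      k * m      ≤⟨ *-monoˡ-≤ m k≤∣C∣ ⟩
      ∣ C ∣ * m  ≤⟨ size ⟩
      ∣ U ∣      ∎

  GLoop-∣P∣≤q : .{{_ : NonZero k}} → two ℚ.≤ β → GLoop d k q β P C P′ C′ →
                Covered β P U → ∣ C ∣ * m ≤ ∣ U ∣ → ∣ P′ ∣ ≤ q
  GLoop-∣P∣≤q β≥2 (stop (inj₁ empty)) _ _ =
    subst (_≤ q) (sym (trans (cong ∣_∣ (Empty-unique empty)) (∣⊥∣≡0 n))) z≤n
  GLoop-∣P∣≤q {C = C} β≥2 (stop (inj₂ k≤∣C∣)) cov size = ∣P∣≤q-at-stop {C = C} β≥2 cov size k≤∣C∣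
  GLoop-∣P∣≤q {β = β} {P = P} {C = C} β≥2 (step s s∈P _ s-min loop) cov size =
    GLoop-∣P∣≤q β≥2 loop (Covered-shrink {P = P} {β = β} s-min cov) (∣C∪⁅s⁆∣*m≤∣Ball∪U∣ {C = C} β≥2 cov s∈P size)

GLoop-∣C∣≤k : ∀ {d : Fin n → Fin n → ℚ} {k q β P C P′ C′} → GLoop d k q β P C P′ C′ → ∣ C ∣ ≤ k → ∣ C′ ∣ ≤ k
GLoop-∣C∣≤k (stop _) ∣C∣≤k = ∣C∣≤k
GLoop-∣C∣≤k {C = C} (step s _ ∣C∣<k _ loop) _ = GLoop-∣C∣≤k loop (≤-trans (∣p∪⁅x⁆∣≤1+∣p∣ C s) ∣C∣<k)

G-∣S∣≤k : ∀ {d : Fin n → Fin n → ℚ} {k q β x} → G d k q β x → ∣ S x ∣ ≤ k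
G-∣S∣≤k {n} (loop , _) = GLoop-∣C∣≤k loop (subst (_≤ _) (sym (∣⊥∣≡0 n)) z≤n)

G-∣O∣≤q : ∀ {d : Fin n → Fin n → ℚ} {k q β x} → IsMetric d → q < n → .{{_ : NonZero k}} →
          two ℚ.≤ β → G d k q β x → ∣ O x ∣ ≤ q
G-∣O∣≤q {n} {k = k} {q} metric q<n β≥2 (loop , _) =
  GLoop-∣P∣≤q metric k q q<n β≥2 loop (λ u∈⊥ → ⊥-elim (∉⊥ u∈⊥)) nothing-covered
  where
  nothing-covered : ∣ ⊥ {n} ∣ * ceilDiv (n ∸ q) k ≤ ∣ ⊥ {n} ∣
  nothing-covered = subst (λ c → c * ceilDiv (n ∸ q) k ≤ c) (sym (∣⊥∣≡0 n)) z≤n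

Feasible : ℕ → ℕ → Solution n → Set
Feasible k q x = ∣ S x ∣ ≤ k × ∣ O x ∣ ≤ q

A3Loop-Feasible : ∀ {d : Fin n → Fin n → ℚ} {k q r β₁ β₂ β cur out} →
                  A3Loop d k q r β₁ β₂ β cur out → Feasible k q cur → Feasible k q out
A3Loop-Feasible done feasible = feasible
A3Loop-Feasible (reject _ _ _ loop) feasible = A3Loop-Feasible loop feasible
A3Loop-Feasible (accept _ Gx ∣O∣≤q loop) _ = A3Loop-Feasible loop (G-∣S∣≤k Gx , ∣O∣≤q)

lemma6 : (n : ℕ) → 1 ≤ n → (d : Fin n → Fin n → ℚ) → IsMetric d →
         (k q l : ℕ) → 1 ≤ k → q < n →
         (out : Solution n) → Algorithm3 d k q l out →
         ∣ S out ∣ ≤ k × ∣ O out ∣ ≤ q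
lemma6 _ _ _ metric (suc _) _ _ _ q<n _ (_ , G-init , loop) =
  A3Loop-Feasible loop (G-∣S∣≤k G-init , G-∣O∣≤q metric q<n ℚ.≤-refl G-init)
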